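{- Let $G\neq1$ be a finite abelian group, $R,L\subseteq G$ with $R=R^{ -1}$, $L=L^{ -1}$, $1\notin R\cup L$, $|L|\le|R|\le 2$, and let $\Gamma=\mathrm{SC}(G;R,L,\{1\})$ be connected. If $\Gamma$ is edge-transitive, then $\Gamma$ is non-normal. Also, if $\Gamma$ is arc-transitive, then $\Gamma$ is non-normal.
   Context: $\mathrm{SC}(G;R,L,\{1\})$ is the graph with vertex set $G\times\{1,2\}$ and edges $\{(x,1),(y,1)\}$ for $yx^{ -1}\in R$, $\{(x,2),(y,2)\}$ for $yx^{ -1}\in L$, and $\{(x,1),(x,2)\}$ for $x\in G$. $R_G=\{\rho_g\mid g\in G\}$ where $(x,i)^{\rho_g}=(xg,i)$; $\Gamma$ is normal if $R_G\trianglelefteq\mathrm{Aut}(\Gamma)$. Edge-transitive (arc-transitive) means $\mathrm{Aut}(\Gamma)$ is transitive on edges (on arcs, i.e. ordered pairs of adjacent vertices). -}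

module Defs where

open import Data.Nat using (ℕ)
open import Data.Fin using (Fin; zero; suc)
open import Data.Fin.Subset using (Subset; _∈_)
open import Data.Product using (Σ; ∃; _×_; _,_)
open import Data.Sum using (_⊎_)
open import Function.Bundles using (_↔_; Inverse; _⇔_)
open import Relation.Binary.PropositionalEquality using (_≡_)
open import Relation.Binary.Construct.Closure.ReflexiveTransitive using (Star)
open import Algebra.Structures using (IsAbelianGroup)

-- A finite abelian group, presented (up to isomorphism) on the carrier Fin n,
-- with propositional equality.
record FinAbGroup (n : ℕ) : Set where
  infixl 7 _∙_
  infix 8 _⁻¹
  field
    _∙_ : Fin n → Fin n → Fin n
    ε : Fin n
    _⁻¹ : Fin n → Fin n
    isAbelianGroup : IsAbelianGroup _≡_ _∙_ ε _⁻¹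

InvClosed : ∀ {n} → FinAbGroup n → Subset n → Set
InvClosed G S = ∀ x → x ∈ S → (x ⁻¹) ∈ S
  where open FinAbGroup G

-- vertex set G × {1,2}; layer 1 is 'zero', layer 2 is 'suc zero'
Vertex : ℕ → Set
Vertex n = Fin n × Fin 2

SC : ∀ {n} → FinAbGroup n → Subset n → Subset n → Vertex n → Vertex n → Set
SC G R L (x , zero) (y , zero) = (y ∙ x ⁻¹) ∈ R
  where open FinAbGroup G
SC G R L (x , suc zero) (y , suc zero) = (y ∙ x ⁻¹) ∈ L
  where open FinAbGroup G
SC G R L (x , zero) (y , suc zero) = x ≡ y
SC G R L (x , suc zero) (y , zero) = x ≡ y

module _ {V : Set} (E : V → V → Set) where

  Connected : Set
  Connected = ∀ u v → Star E u v

  record Automorphism : Set where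
    field
      perm : V ↔ V
      preserves : ∀ u v → E u v ⇔ E (Inverse.to perm u) (Inverse.to perm v)

  open Automorphism

  app : Automorphism → V → V
  app σ = Inverse.to (perm σ)

  EdgeTransitive : Set
  EdgeTransitive = ∀ u v u′ v′ → E u v → E u′ v′ →
    Σ Automorphism λ σ →
      (app σ u ≡ u′ × app σ v ≡ v′) ⊎ (app σ u ≡ v′ × app σ v ≡ u′)

  ArcTransitive : Set
  ArcTransitive = ∀ u v u′ v′ → E u v → E u′ v′ →
    Σ Automorphism λ σ → app σ u ≡ u′ × app σ v ≡ v′

ρ : ∀ {n} → FinAbGroup n → Fin n → Vertex n → Vertex n
ρ G g (x , i) = (x ∙ g , i)
  where open FinAbGroup G

-- R_G ⊴ Aut(Γ): R_G is closed under conjugation by every automorphism σ,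
-- i.e. σ⁻¹ ρ_g σ = ρ_h for some h.  (Each ρ_g is always an automorphism of SC.)
IsNormal : ∀ {n} (G : FinAbGroup n) (E : Vertex n → Vertex n → Set) → Set
IsNormal G E = ∀ (σ : Automorphism E) (g : Fin _) → ∃ λ h →
  ∀ v → Inverse.from (Automorphism.perm σ) (ρ G g (app E σ v)) ≡ ρ G h v

-- Every translation ρ_h fixes both layers G × {1} and G × {2}, while R_G moves any vertex
-- to any other vertex of its layer.  Hence if R_G is normal in Aut(Γ), every automorphism σ
-- preserves the partition into layers: for u, v with σ u, σ v in one layer, choose ρ_g with
-- ρ_g (σ u) = σ v; then v = σ⁻¹ ρ_g σ u = ρ_h u lies in the layer of u.  An edge-transitive
-- Γ, however, maps a spoke (x,1) ~ (x,2) onto any edge inside layer 1, and such an edge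
-- exists: if R = ∅ then L = ∅ as |L| ≤ |R|, and Γ is a perfect matching on |G| ≥ 2 spokes,
-- which is disconnected.
module Submission where

open import Defs
open import Algebra.Bundles using (AbelianGroup)
import Algebra.Properties.Group as GroupProperties
open import Data.Nat using (_≤_; s≤s)
open import Data.Nat.Properties using (≤-trans)
open import Data.Fin using (Fin; zero; suc)
open import Data.Fin.Subset using (Subset; _∈_; _∉_; ∣_∣; Nonempty; Empty)
open import Data.Fin.Subset.Properties
  using (nonempty?; Empty-unique; ∣⊥∣≡0; x∈⁅y⁆⇒x≡y; ∣⁅x⁆∣≡1; p⊆q⇒∣p∣≤∣q∣)
open import Data.Product using (_×_; _,_; proj₁; proj₂)
open import Data.Sum using (inj₁; inj₂)
open import Data.Empty using (⊥-elim)
open import Function using (_∘_)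
open import Function.Bundles using (Inverse)
open import Relation.Nullary using (¬_; yes; no)
open import Relation.Binary.PropositionalEquality
  using (_≡_; _≢_; refl; sym; trans; cong; subst; module ≡-Reasoning)
open import Relation.Binary.Construct.Closure.ReflexiveTransitive using (fold)

layer : ∀ {n} → Vertex n → Fin 2
layer = proj₂

Nonempty⇒1≤∣p∣ : ∀ {n} {p : Subset n} → Nonempty p → 1 ≤ ∣ p ∣
Nonempty⇒1≤∣p∣ {p = p} (x , x∈p) = subst (_≤ ∣ p ∣) (∣⁅x⁆∣≡1 x)
  (p⊆q⇒∣p∣≤∣q∣ λ y∈⁅x⁆ → subst (_∈ p) (sym (x∈⁅y⁆⇒x≡y _ y∈⁅x⁆)) x∈p)

Empty⇒∣p∣≡0 : ∀ {n} {p : Subset n} → Empty p → ∣ p ∣ ≡ 0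
Empty⇒∣p∣≡0 {n} p-empty = trans (cong ∣_∣ (Empty-unique p-empty)) (∣⊥∣≡0 n)

∣p∣≤∣q∣⇒Empty[q]⇒Empty[p] : ∀ {n} {p q : Subset n} → ∣ p ∣ ≤ ∣ q ∣ → Empty q → Empty p
∣p∣≤∣q∣⇒Empty[q]⇒Empty[p] ∣p∣≤∣q∣ q-empty p-nonempty
  with subst (1 ≤_) (Empty⇒∣p∣≡0 q-empty) (≤-trans (Nonempty⇒1≤∣p∣ p-nonempty) ∣p∣≤∣q∣)
... | ()

arcTransitive⇒edgeTransitive : ∀ {V : Set} {E : V → V → Set} →
  ArcTransitive E → EdgeTransitive E
arcTransitive⇒edgeTransitive at u v u′ v′ uv u′v′ with at u v u′ v′ uv u′v′
... | σ , σu≡u′ , σv≡v′ = σ , inj₁ (σu≡u′ , σv≡v′)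

module _ {n} (G : FinAbGroup n) where
  open FinAbGroup G

  abelianGroup : AbelianGroup _ _
  abelianGroup = record { isAbelianGroup = isAbelianGroup }

  open GroupProperties (AbelianGroup.group abelianGroup) using (\\-leftDividesˡ; ε⁻¹≈ε)
  open AbelianGroup abelianGroup using (identityʳ)

  ρ-preserves-layer : ∀ g v → layer (ρ G g v) ≡ layer v
  ρ-preserves-layer g (x , i) = refl

  ρ-transitive-on-layer : ∀ (u v : Vertex n) → layer u ≡ layer v →
    ρ G (proj₁ u ⁻¹ ∙ proj₁ v) u ≡ v
  ρ-transitive-on-layer (a , i) (b , .i) refl = cong (_, i) (\\-leftDividesˡ a b)

  module _ {E : Vertex n → Vertex n → Set} where

    normal⇒layer-preserving : IsNormal G E → (σ : Automorphism E) →
      ∀ u v → layer (app E σ u) ≡ layer (app E σ v) → layer u ≡ layer v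
    normal⇒layer-preserving normal σ u v same-layer =
      trans (sym (ρ-preserves-layer h u)) (cong layer (sym v≡ρ-h-u))
      where
      open Inverse (Automorphism.perm σ) using (to; from; strictlyInverseʳ)
      g : Fin n
      g = proj₁ (to u) ⁻¹ ∙ proj₁ (to v)
      h : Fin n
      h = proj₁ (normal σ g)
      open ≡-Reasoning
      v≡ρ-h-u : v ≡ ρ G h u
      v≡ρ-h-u = begin
        v                   ≡⟨ strictlyInverseʳ v ⟨
        from (to v)         ≡⟨ cong from (ρ-transitive-on-layer (to u) (to v) same-layer) ⟨
        from (ρ G g (to u)) ≡⟨ proj₂ (normal σ g) u ⟩
        ρ G h u             ∎

    edgeTransitive⇒¬normal : EdgeTransitive E →
      ∀ {u v u′ v′} → E u v → layer u ≢ layer v → E u′ v′ → layer u′ ≡ layer v′ →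
      ¬ IsNormal G E
    edgeTransitive⇒¬normal et {u} {v} {u′} {v′} uv across u′v′ within normal
      with et u v u′ v′ uv u′v′
    ... | σ , inj₁ (σu≡u′ , σv≡v′) = across (normal⇒layer-preserving normal σ u v
      (trans (cong layer σu≡u′) (trans within (cong layer (sym σv≡v′)))))
    ... | σ , inj₂ (σu≡v′ , σv≡u′) = across (normal⇒layer-preserving normal σ u v
      (trans (cong layer σu≡v′) (trans (sym within) (cong layer (sym σv≡u′)))))

  module _ (R L : Subset n) where

    spoke : ∀ x → SC G R L (x , zero) (x , suc zero)
    spoke x = refl

    R-edge : ∀ {r} → r ∈ R → SC G R L (ε , zero) (r , zero)
    R-edge {r} r∈R = subst (_∈ R) (sym r∙ε⁻¹≡r) r∈R
      where
      r∙ε⁻¹≡r : r ∙ ε ⁻¹ ≡ r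
      r∙ε⁻¹≡r = trans (cong (r ∙_) ε⁻¹≈ε) (identityʳ r)

    SC-edgeTransitive⇒¬normal : ∀ {r} → r ∈ R →
      EdgeTransitive (SC G R L) → ¬ IsNormal G (SC G R L)
    SC-edgeTransitive⇒¬normal {r} r∈R et = edgeTransitive⇒¬normal et
      {ε , zero} {ε , suc zero} {ε , zero} {r , zero} (spoke ε) (λ ()) (R-edge r∈R) refl

    SC-edge-within-fibre : Empty R → Empty L → ∀ {u v} → SC G R L u v → proj₁ u ≡ proj₁ v
    SC-edge-within-fibre R-empty L-empty {_ , zero} {_ , zero} uv = ⊥-elim (R-empty (_ , uv))
    SC-edge-within-fibre R-empty L-empty {_ , zero} {_ , suc zero} uv = uv
    SC-edge-within-fibre R-empty L-empty {_ , suc zero} {_ , zero} uv = uv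
    SC-edge-within-fibre R-empty L-empty {_ , suc zero} {_ , suc zero} uv = ⊥-elim (L-empty (_ , uv))

    SC-disconnected : Empty R → Empty L → 2 ≤ n → ¬ Connected (SC G R L)
    SC-disconnected R-empty L-empty (s≤s (s≤s _)) connected
      with fold (λ u v → proj₁ u ≡ proj₁ v)
             (λ uw wv → trans (SC-edge-within-fibre R-empty L-empty uw) wv) refl
             (connected (zero , zero) (suc zero , zero))
    ... | ()

lemma3p1 : ∀ {n} (G : FinAbGroup n) (R L : Subset n) →
    2 ≤ n →
    InvClosed G R → InvClosed G L →
    FinAbGroup.ε G ∉ R → FinAbGroup.ε G ∉ L →
    ∣ L ∣ ≤ ∣ R ∣ → ∣ R ∣ ≤ 2 →
    Connected (SC G R L) →
    (EdgeTransitive (SC G R L) → ¬ IsNormal G (SC G R L)) ×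
    (ArcTransitive (SC G R L) → ¬ IsNormal G (SC G R L))
lemma3p1 G R L 2≤n _ _ _ _ ∣L∣≤∣R∣ _ connected with nonempty? R
... | no R-empty = ⊥-elim (SC-disconnected G R L R-empty
                             (∣p∣≤∣q∣⇒Empty[q]⇒Empty[p] ∣L∣≤∣R∣ R-empty) 2≤n connected)
... | yes (_ , r∈R) = ¬normal , ¬normal ∘ arcTransitive⇒edgeTransitive
  where
  ¬normal : EdgeTransitive (SC G R L) → ¬ IsNormal G (SC G R L)
  ¬normal = SC-edgeTransitive⇒¬normal G R L r∈R
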